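{- There exist trees on $n$ vertices that require $\Omega(\sqrt{n})$ colours to be subset square coloured; i.e. there is a constant $\alpha>0$ such that for infinitely many $n$ there is a tree $T$ on $n$ vertices with $\chi_{ssc}(T)\ge\alpha\sqrt{n}$.
   Context: Graphs are finite, simple and undirected. For a vertex $v$, $N(v)$ is its open neighbourhood, $N[v]=N(v)\cup\{v\}$ and $\deg(v)=|N(v)|$. For a positive integer $q$, a $q$-subset square colouring of a graph $G$ is a function $c:V(G)\to\{c_0,c_1,\dots,c_q\}$ such that (i) for every vertex $v$ and every $i\in\{1,\dots,q\}$, $|c^{ -1}(c_i)\cap N[v]|\le 1$, and (ii) for every vertex $v$, $N[v]$ contains at most $\deg(v)$ vertices of colour $c_0$ (equivalently, $N[v]$ contains at least one vertex whose colour lies in $\{c_1,\dots,c_q\}$). $\chi_{ssc}(G)$ is the minimum $q$ such that $G$ admits a $q$-subset square colouring. -}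

module Defs where

open import Data.Nat using (ℕ; zero; suc; _≤_)
open import Data.Fin using (Fin; zero; suc)
open import Data.Bool using (Bool; true; false)
open import Data.List using (List; []; _∷_; length; last)
open import Data.List.Relation.Unary.Unique.Propositional using (Unique)
open import Data.Maybe using (just)
open import Data.Product using (Σ; _×_; ∃; ∃-syntax; _,_)
open import Data.Sum using (_⊎_)
open import Relation.Binary.PropositionalEquality using (_≡_; _≢_)
open import Relation.Nullary using (¬_)

record Graph (n : ℕ) : Set where
  field
    Adj   : Fin n → Fin n → Bool
    sym   : ∀ u v → Adj u v ≡ Adj v u
    irrefl : ∀ v → Adj v v ≡ false
open Graph public

module _ {n : ℕ} (G : Graph n) where

  Adjacent : Fin n → Fin n → Set
  Adjacent u v = Adj G u v ≡ true

  InClosedNbhd : Fin n → Fin n → Set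
  InClosedNbhd v u = (u ≡ v) ⊎ Adjacent v u

  data Walk : Fin n → Fin n → Set where
    here : ∀ {v} → Walk v v
    step : ∀ {u w v} → Adjacent u w → Walk w v → Walk u v

  Connected : Set
  Connected = ∀ u v → Walk u v

  ConsecAdj : List (Fin n) → Set
  ConsecAdj [] = Data.Unit.⊤ where import Data.Unit
  ConsecAdj (x ∷ []) = Data.Unit.⊤ where import Data.Unit
  ConsecAdj (x ∷ y ∷ xs) = Adjacent x y × ConsecAdj (y ∷ xs)

  IsCycle : List (Fin n) → Set
  IsCycle [] = Data.Empty.⊥ where import Data.Empty
  IsCycle (v₀ ∷ vs) =
    3 ≤ length (v₀ ∷ vs) × Unique (v₀ ∷ vs) × ConsecAdj (v₀ ∷ vs)
    × ∃[ vₖ ] (last (v₀ ∷ vs) ≡ just vₖ × Adjacent vₖ v₀)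

  Acyclic : Set
  Acyclic = ∀ (cs : List (Fin n)) → ¬ IsCycle cs

IsTree : ∀ {n} → Graph n → Set
IsTree {n} G = 1 ≤ n × Connected G × Acyclic G

-- q-subset square colouring: colours Fin (suc q); zero plays the role of c₀,
-- suc i plays the role of c_{i+1}.
IsSubsetSquareColouring : ∀ {n} (G : Graph n) (q : ℕ) → (Fin n → Fin (suc q)) → Set
IsSubsetSquareColouring {n} G q c =
  (∀ v u w (i : Fin q) → InClosedNbhd G v u → InClosedNbhd G v w →
     c u ≡ suc i → c w ≡ suc i → u ≡ w)
  -- (ii) N[v] contains at most deg(v) vertices of colour c₀, i.e. some vertex of
  -- N[v] has a colour in {c₁,…,c_q}
  × (∀ v → ∃[ u ] (InClosedNbhd G v u × c u ≢ zero))

HasSubsetSquareColouring : ∀ {n} → Graph n → ℕ → Set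
HasSubsetSquareColouring {n} G q = Σ (Fin n → Fin (suc q)) (IsSubsetSquareColouring G q)

-- A vertex whose colour is c₀ forces every pendant neighbour to carry a proper colour, and
-- the proper colours in a closed neighbourhood are pairwise distinct. In the complete m-ary
-- tree of depth two (1 + m + m² vertices) either some child of the root has colour c₀, and
-- then its m leaves need m distinct proper colours, or all m children of the root do. Hence
-- m ≤ q, so the number of vertices is at most 4q².
module Submission where

open import Defs
open import Data.Nat using (ℕ; _≤_; _*_)
open import Data.Product using (∃-syntax; _×_; Σ)

open import Data.Nat using (suc; _+_; s≤s; z≤n; >-nonZero)
open import Data.Nat.Properties
  using (≤-trans; m≤m+n; n≤1+n; m≤m*n; +-mono-≤; +-monoʳ-≤; *-mono-≤; module ≤-Reasoning)
open import Data.Fin using (Fin; zero; suc; _↑ˡ_; _↑ʳ_; splitAt; combine; remQuot; join; punchOut)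
open import Data.Fin.Properties
  using (_≟_; splitAt-↑ˡ; splitAt-↑ʳ; remQuot-combine; combine-remQuot; join-splitAt;
         punchOut-injective; injective⇒≤; any?)
open import Data.List using ([]; _∷_; last)
open import Data.List.Membership.Propositional using (_∈_)
open import Data.List.Relation.Unary.All using (All; []; _∷_)
import Data.List.Relation.Unary.All as All
open import Data.List.Relation.Unary.Any using (here; there)
open import Data.List.Relation.Unary.AllPairs using (_∷_)
open import Data.Maybe using (just)
open import Data.Product using (_,_; proj₁; proj₂; uncurry)
open import Data.Sum using (_⊎_; inj₁; inj₂)
open import Data.Empty using (⊥-elim)
open import Function using (_∘_)
open import Relation.Nullary using (¬_; Dec; yes; no; does)
open import Relation.Nullary.Decidable using (dec-true; dec-false; does-⇔; map′)
open import Function.Bundles using (mk⇔)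
open import Relation.Binary.PropositionalEquality
  using (_≡_; _≢_; refl; cong; subst; subst₂) renaming (sym to ≡-sym; trans to ≡-trans)

record BridgeSide {A : Set} (_~_ : A → A → Set) (u v : A) : Set₁ where
  field
    Side   : A → Set
    v∈Side : Side v
    closed : ∀ {x y} → Side x → x ~ y → y ≢ u → Side y
    only-v : ∀ {x} → Side x → x ~ u → x ≡ v

comapBridgeSide : ∀ {A B : Set} {_~_ : A → A → Set} {_≈_ : B → B → Set} (f : B → A) →
                  (∀ {x y} → f x ≡ f y → x ≡ y) → (∀ {x y} → x ≈ y → f x ~ f y) →
                  ∀ {u v} → BridgeSide _~_ (f u) (f v) → BridgeSide _≈_ u v
comapBridgeSide f f-inj f-hom S = record
  { Side   = Side ∘ f
  ; v∈Side = v∈Side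
  ; closed = λ x∈S x≈y y≢u → closed x∈S (f-hom x≈y) (y≢u ∘ f-inj)
  ; only-v = λ x∈S x≈u → f-inj (only-v x∈S (f-hom x≈u))
  }
  where open BridgeSide S

module _ {n : ℕ} (G : Graph n) where

  adjacent-sym : ∀ {u v} → Adjacent G u v → Adjacent G v u
  adjacent-sym {u} {v} u~v = ≡-trans (Graph.sym G v u) u~v

  _++ʷ_ : ∀ {u v w} → Walk G u v → Walk G v w → Walk G u w
  here       ++ʷ q = q
  step u~w p ++ʷ q = step u~w (p ++ʷ q)

  reverseʷ : ∀ {u v} → Walk G u v → Walk G v u
  reverseʷ here         = here
  reverseʷ (step u~w p) = reverseʷ p ++ʷ step (adjacent-sym u~w) here

  walks-to-hub⇒connected : ∀ r → (∀ v → Walk G v r) → Connected G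
  walks-to-hub⇒connected r to-r u v = to-r u ++ʷ reverseʷ (to-r v)

  path-stays-in-side : ∀ {u v} (S : BridgeSide (Adjacent G) u v) x xs →
                       ConsecAdj G (x ∷ xs) → All (u ≢_) xs → BridgeSide.Side S x →
                       ∀ {y} → last (x ∷ xs) ≡ just y → BridgeSide.Side S y
  path-stays-in-side S x []        _            _           x∈S refl = x∈S
  path-stays-in-side S x (x′ ∷ xs) (x~x′ , adj) (u≢x′ ∷ u≢) x∈S eq   =
    path-stays-in-side S x′ xs adj u≢ (BridgeSide.closed S x∈S x~x′ (u≢x′ ∘ ≡-sym)) eq

  last-∈-tail : ∀ (x x′ : Fin n) xs {y} → last (x ∷ x′ ∷ xs) ≡ just y → y ∈ x′ ∷ xs
  last-∈-tail x x′ []         refl = here refl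
  last-∈-tail x x′ (x″ ∷ xs) eq   = there (last-∈-tail x′ x″ xs eq)

  -- Walk round the cycle from v₁ back to vₖ: it never meets v₀, so vₖ lies on the side of
  -- v₁ and is adjacent to v₀, forcing vₖ = v₁, which uniqueness forbids.
  bridges⇒acyclic : (∀ {u v} → Adjacent G u v → BridgeSide (Adjacent G) u v) → Acyclic G
  bridges⇒acyclic bridge (_ ∷ [])          (s≤s () , _)
  bridges⇒acyclic bridge (_ ∷ _ ∷ [])      (s≤s (s≤s ()) , _)
  bridges⇒acyclic bridge (v₀ ∷ v₁ ∷ x ∷ xs)
                  (_ , (v₀∉ ∷ v₁∉ ∷ _) , (v₀~v₁ , adj) , vₖ , eq , vₖ~v₀) =
    All.lookup v₁∉ (last-∈-tail v₁ x xs eq) (≡-sym (only-v vₖ∈S vₖ~v₀))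
    where
    S = bridge v₀~v₁
    open BridgeSide S
    vₖ∈S : Side vₖ
    vₖ∈S = path-stays-in-side S v₁ (x ∷ xs) adj (All.tail v₀∉) v∈Side eq

module _ {n q : ℕ} (G : Graph n) (c : Fin n → Fin (suc q))
         (colouring : IsSubsetSquareColouring G q c) where

  private
    proper-unique = proj₁ colouring
    dominated     = proj₂ colouring

  proper-colour-unique-in-closedNbhd : ∀ {v u w} → InClosedNbhd G v u → InClosedNbhd G v w →
                                       c u ≢ zero → c u ≡ c w → u ≡ w
  proper-colour-unique-in-closedNbhd {v} {u} {w} u∈ w∈ cu≢0 cu≡cw with c u in cu≡
  ... | zero  = ⊥-elim (cu≢0 refl)
  ... | suc i = proper-unique v u w i u∈ w∈ cu≡ (≡-sym cu≡cw)

  properly-coloured-closedNbhd⇒≤ : ∀ {m} v (f : Fin m → Fin n) → (∀ {i j} → f i ≡ f j → i ≡ j) →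
                                   (∀ i → InClosedNbhd G v (f i)) → (∀ i → c (f i) ≢ zero) → m ≤ q
  properly-coloured-closedNbhd⇒≤ {m} v f f-inj f∈ f≢0 = injective⇒≤ {f = proper-colour} proper-colour-inj
    where
    -- punchOut renumbers the proper colours c₁ … c_q of Fin (suc q) as Fin q
    proper-colour : Fin m → Fin q
    proper-colour i = punchOut (f≢0 i ∘ ≡-sym)
    proper-colour-inj : ∀ {i j} → proper-colour i ≡ proper-colour j → i ≡ j
    proper-colour-inj {i} {j} eq = f-inj (proper-colour-unique-in-closedNbhd (f∈ i) (f∈ j) (f≢0 i)
      (punchOut-injective (f≢0 i ∘ ≡-sym) (f≢0 j ∘ ≡-sym) eq))

  pendant-at-c₀⇒proper : ∀ {u w} → (∀ {x} → Adjacent G u x → x ≡ w) → c w ≡ zero → c u ≢ zero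
  pendant-at-c₀⇒proper {u} only-w cw≡0 with dominated u
  ... | _ , inj₁ refl , cu≢0 = cu≢0
  ... | _ , inj₂ u~x  , cx≢0 = λ _ → cx≢0 (subst (λ y → c y ≡ zero) (≡-sym (only-w u~x)) cw≡0)

module DepthTwoTree (m : ℕ) where

  data Vertex : Set where
    root : Vertex
    mid  : Fin m → Vertex
    leaf : Fin m → Fin m → Vertex

  data Edge : Vertex → Vertex → Set where
    root-mid : ∀ {i}   → Edge root (mid i)
    mid-root : ∀ {i}   → Edge (mid i) root
    mid-leaf : ∀ {i j} → Edge (mid i) (leaf i j)
    leaf-mid : ∀ {i j} → Edge (leaf i j) (mid i)

  edge-sym : ∀ {a b} → Edge a b → Edge b a
  edge-sym root-mid = mid-root
  edge-sym mid-root = root-mid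
  edge-sym mid-leaf = leaf-mid
  edge-sym leaf-mid = mid-leaf

  edge? : ∀ a b → Dec (Edge a b)
  edge? root       (mid _)    = yes root-mid
  edge? (mid _)    root       = yes mid-root
  edge? (mid i)    (leaf j _) = map′ (λ { refl → mid-leaf }) (λ { mid-leaf → refl }) (i ≟ j)
  edge? (leaf j _) (mid i)    = map′ (λ { refl → leaf-mid }) (λ { leaf-mid → refl }) (i ≟ j)
  edge? root       root       = no λ ()
  edge? root       (leaf _ _) = no λ ()
  edge? (mid _)    (mid _)    = no λ ()
  edge? (leaf _ _) root       = no λ ()
  edge? (leaf _ _) (leaf _ _) = no λ ()

  size : ℕ
  size = suc (m + m * m)

  encode : Vertex → Fin size
  encode root       = zero
  encode (mid i)    = suc (i ↑ˡ (m * m))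
  encode (leaf i j) = suc (m ↑ʳ combine i j)

  decode-non-root : Fin m ⊎ Fin (m * m) → Vertex
  decode-non-root (inj₁ i) = mid i
  decode-non-root (inj₂ k) = uncurry leaf (remQuot {m} m k)

  decode : Fin size → Vertex
  decode zero    = root
  decode (suc x) = decode-non-root (splitAt m x)

  decode∘encode : ∀ a → decode (encode a) ≡ a
  decode∘encode root       = refl
  decode∘encode (mid i)    rewrite splitAt-↑ˡ m i (m * m) = refl
  decode∘encode (leaf i j) rewrite splitAt-↑ʳ m (m * m) (combine i j) =
    cong (uncurry leaf) (remQuot-combine {m} i j)

  encode∘decode : ∀ x → encode (decode x) ≡ x
  encode∘decode zero    = refl
  encode∘decode (suc x) = ≡-trans (non-root (splitAt m x)) (cong suc (join-splitAt m (m * m) x))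
    where
    non-root : ∀ s → encode (decode-non-root s) ≡ suc (join m (m * m) s)
    non-root (inj₁ i) = refl
    non-root (inj₂ k) = cong (suc ∘ (m ↑ʳ_)) (combine-remQuot {m} m k)

  encode-injective : ∀ {a b} → encode a ≡ encode b → a ≡ b
  encode-injective {a} {b} eq =
    subst₂ _≡_ (decode∘encode a) (decode∘encode b) (cong decode eq)

  decode-injective : ∀ {x y} → decode x ≡ decode y → x ≡ y
  decode-injective {x} {y} eq =
    subst₂ _≡_ (encode∘decode x) (encode∘decode y) (cong encode eq)

  no-loop : ∀ {a} → ¬ Edge a a
  no-loop ()

  tree : Graph size
  tree = record
    { Adj    = λ x y → does (edge? (decode x) (decode y))
    ; sym    = λ x y → does-⇔ (mk⇔ edge-sym edge-sym) (edge? (decode x) (decode y))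
                                                     (edge? (decode y) (decode x))
    ; irrefl = λ x → dec-false (edge? (decode x) (decode x)) no-loop
    }

  adjacent⇒edge : ∀ {x y} → Adjacent tree x y → Edge (decode x) (decode y)
  adjacent⇒edge {x} {y} adj with edge? (decode x) (decode y)
  ... | yes e = e
  ... | no _  with () ← adj

  edge⇒adjacent : ∀ {a b} → Edge a b → Adjacent tree (encode a) (encode b)
  edge⇒adjacent {a} {b} e =
    dec-true (edge? _ _) (subst₂ Edge (≡-sym (decode∘encode a)) (≡-sym (decode∘encode b)) e)

  walk-to-root : ∀ a → Walk tree (encode a) (encode root)
  walk-to-root root       = here
  walk-to-root (mid i)    = step (edge⇒adjacent mid-root) here
  walk-to-root (leaf i j) = step (edge⇒adjacent leaf-mid) (walk-to-root (mid i))

  tree-connected : Connected tree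
  tree-connected = walks-to-hub⇒connected tree zero λ x →
    subst (λ y → Walk tree y zero) (encode∘decode x) (walk-to-root (decode x))

  data InBranch (i : Fin m) : Vertex → Set where
    mid  : InBranch i (mid i)
    leaf : ∀ {j} → InBranch i (leaf i j)

  edge-bridgeSide : ∀ {a b} → Edge a b → BridgeSide Edge a b
  edge-bridgeSide (root-mid {i}) = record
    { Side = InBranch i ; v∈Side = mid ; closed = closed ; only-v = λ { mid mid-root → refl } }
    where
    closed : ∀ {x y} → InBranch i x → Edge x y → y ≢ root → InBranch i y
    closed mid  mid-root y≢root = ⊥-elim (y≢root refl)
    closed mid  mid-leaf _      = leaf
    closed leaf leaf-mid _      = mid
  edge-bridgeSide (mid-root {i}) = record
    { Side = ¬_ ∘ InBranch i ; v∈Side = λ () ; closed = closed ; only-v = only-root }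
    where
    closed : ∀ {x y} → ¬ InBranch i x → Edge x y → y ≢ mid i → ¬ InBranch i y
    closed _   _        y≢mid mid  = y≢mid refl
    closed x∉ mid-leaf _     leaf = x∉ mid
    only-root : ∀ {x} → ¬ InBranch i x → Edge x (mid i) → x ≡ root
    only-root _  root-mid = refl
    only-root x∉ leaf-mid = ⊥-elim (x∉ leaf)
  edge-bridgeSide (mid-leaf {i} {j}) = record
    { Side = _≡ leaf i j ; v∈Side = refl ; closed = closed ; only-v = λ x≡leaf _ → x≡leaf }
    where
    closed : ∀ {x y} → x ≡ leaf i j → Edge x y → y ≢ mid i → y ≡ leaf i j
    closed refl leaf-mid y≢mid = ⊥-elim (y≢mid refl)
  edge-bridgeSide (leaf-mid {i} {j}) = record
    { Side = _≢ leaf i j ; v∈Side = λ () ; closed = λ _ _ y≢leaf → y≢leaf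
    ; only-v = λ { _ mid-leaf → refl } }

  tree-acyclic : Acyclic tree
  tree-acyclic = bridges⇒acyclic tree λ {x} {y} x~y →
    comapBridgeSide decode decode-injective (λ {x′} {y′} → adjacent⇒edge {x′} {y′})
      (edge-bridgeSide (adjacent⇒edge {x} {y} x~y))

  adjacent-encoded⇒edge : ∀ {a y} → Adjacent tree (encode a) y → Edge a (decode y)
  adjacent-encoded⇒edge {a} {y} adj =
    subst (λ a′ → Edge a′ (decode y)) (decode∘encode a) (adjacent⇒edge {encode a} {y} adj)

  leaf-parent : ∀ {i j b} → Edge (leaf i j) b → b ≡ mid i
  leaf-parent leaf-mid = refl

  leaf-only-neighbour : ∀ {i j y} → Adjacent tree (encode (leaf i j)) y → y ≡ encode (mid i)
  leaf-only-neighbour {y = y} adj =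
    ≡-trans (≡-sym (encode∘decode y)) (cong encode (leaf-parent (adjacent-encoded⇒edge {y = y} adj)))

  colours-≥-branching : ∀ {q} → HasSubsetSquareColouring tree q → m ≤ q
  colours-≥-branching (c , colouring) with any? (λ i → c (encode (mid i)) ≟ zero)
  ... | yes (i , c-mid≡0) =
    properly-coloured-closedNbhd⇒≤ tree c colouring (encode (mid i)) (encode ∘ leaf i)
      (λ {j} {j′} eq → leaf-injectiveʳ (encode-injective {leaf i j} {leaf i j′} eq))
      (λ _ → inj₂ (edge⇒adjacent mid-leaf))
      (λ _ → pendant-at-c₀⇒proper tree c colouring leaf-only-neighbour c-mid≡0)
    where
    leaf-injectiveʳ : ∀ {j j′} → leaf i j ≡ leaf i j′ → j ≡ j′
    leaf-injectiveʳ refl = refl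
  ... | no no-mid-at-c₀ =
    properly-coloured-closedNbhd⇒≤ tree c colouring (encode root) (encode ∘ mid)
      (λ {i} {i′} eq → mid-injective (encode-injective {mid i} {mid i′} eq))
      (λ _ → inj₂ (edge⇒adjacent root-mid))
      (λ i c-mid≡0 → no-mid-at-c₀ (i , c-mid≡0))
    where
    mid-injective : ∀ {i i′} → mid i ≡ mid i′ → i ≡ i′
    mid-injective refl = refl

  size≤4q² : ∀ {q} → 1 ≤ q → m ≤ q → size ≤ 2 * 2 * (q * q)
  size≤4q² {q} 1≤q m≤q = begin
    suc (m + m * m)         ≤⟨ +-mono-≤ 1≤q² (+-mono-≤ m≤q² (*-mono-≤ m≤q m≤q)) ⟩
    q * q + (q * q + q * q) ≤⟨ +-monoʳ-≤ (q * q) (+-monoʳ-≤ (q * q) (m≤m+n (q * q) _)) ⟩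
    2 * 2 * (q * q)         ∎
    where
    open ≤-Reasoning
    1≤q² : 1 ≤ q * q
    1≤q² = *-mono-≤ 1≤q 1≤q
    m≤q² : m ≤ q * q
    m≤q² = ≤-trans m≤q (m≤m*n q q {{>-nonZero 1≤q}})

mainTheorem17 : ∃[ k ] (1 ≤ k × (∀ (N : ℕ) → ∃[ n ] (N ≤ n × Σ (Graph n) λ T → IsTree T × (∀ (q : ℕ) → 1 ≤ q → HasSubsetSquareColouring T q → n ≤ k * k * (q * q)))))
mainTheorem17 = 2 , s≤s z≤n , λ m →
  size m , ≤-trans (m≤m+n m (m * m)) (n≤1+n _) ,
  tree m , (s≤s z≤n , tree-connected m , tree-acyclic m) ,
  λ q 1≤q colouring → size≤4q² m 1≤q (colours-≥-branching m colouring)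
  where open DepthTwoTree
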